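{- The complete bipartite graph $K_{3,3}$ admits no nowhere-zero $\mathbb{Z}_2^3$-flow in which all three edges incident to some vertex are rich.
   Context: A nowhere-zero $\mathbb{Z}_2^3$-flow of a graph $G$ is a map $\theta:E(G)\to\mathbb{Z}_2^3\setminus\{0\}$ such that at every vertex the sum of $\theta$ over the incident edges is $0$ (no orientation needed). Writing $S_\theta(v)$ for the set of values of $\theta$ on edges incident to $v$, an edge $uv$ of a cubic graph is rich in $\theta$ if $|S_\theta(u)\cup S_\theta(v)|=5$. -}

module Defs where

open import Data.Bool using (Bool; true; false; _xor_)
open import Data.Fin using (Fin)
open import Data.Product using (_×_; _,_; proj₁; proj₂)
open import Data.List using (List; _∷_; []; _++_; map; length; deduplicate)
open import Data.List using (allFin)
open import Data.Nat using (ℕ)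
open import Relation.Binary.PropositionalEquality using (_≡_; _≢_)
open import Relation.Binary using (DecidableEquality)
import Data.Bool.Properties as B
open import Data.Product.Properties using (≡-dec)

Z2³ : Set
Z2³ = Bool × Bool × Bool

zero³ : Z2³
zero³ = false , false , false

_⊕_ : Z2³ → Z2³ → Z2³
(a , b , c) ⊕ (a' , b' , c') = (a xor a') , (b xor b') , (c xor c')

_≟³_ : DecidableEquality Z2³
_≟³_ = ≡-dec B._≟_ (≡-dec B._≟_ B._≟_)

-- The complete bipartite graph K_{3,3}: vertices are L i / R j (i, j : Fin 3),
-- and the edges are the pairs (i , j), the edge (i , j) joining L i and R j.
data Vertex : Set where
  L : Fin 3 → Vertex
  R : Fin 3 → Vertex

Edge : Set
Edge = Fin 3 × Fin 3

Incident : Vertex → Edge → Set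
Incident (L i) e = proj₁ e ≡ i
Incident (R j) e = proj₂ e ≡ j

Labelling : Set
Labelling = Edge → Z2³

sumAt : Labelling → Vertex → Z2³
sumAt θ (L i) = θ (i , Fin.zero) ⊕ (θ (i , Fin.suc Fin.zero) ⊕ θ (i , Fin.suc (Fin.suc Fin.zero)))
sumAt θ (R j) = θ (Fin.zero , j) ⊕ (θ (Fin.suc Fin.zero , j) ⊕ θ (Fin.suc (Fin.suc Fin.zero) , j))

record NowhereZeroFlow (θ : Labelling) : Set where
  field
    nowhereZero : ∀ e → θ e ≢ zero³
    conservation : ∀ v → sumAt θ v ≡ zero³

S : Labelling → Vertex → List Z2³
S θ (L i) = map (λ j → θ (i , j)) (allFin 3)
S θ (R j) = map (λ i → θ (i , j)) (allFin 3)

unionSize : Labelling → Edge → ℕ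
unionSize θ (i , j) = length (deduplicate _≟³_ (S θ (L i) ++ S θ (R j)))

Rich : Labelling → Edge → Set
Rich θ e = unionSize θ e ≡ 5

-- Suppose the three edges at L i are rich (the case R j follows by transposing K_{3,3}).
-- The values x, y, x ⊕ y on row i span a plane P of Z_2^3, and n = cross x y is the
-- linear form with kernel P. Column j sums to zero and contains θ (i , j) ∈ P, so its
-- two other entries are both in P or both outside it; in the first case all six values
-- of row i and column j lie in the four-element set P and (i , j) is not rich. Hence
-- any other row k has n-value true on all three of its edges, whereas n applied to the
-- zero sum of row k gives false.
module Submission where

open import Defs
open import Data.Bool using (Bool; true; false; _xor_; _∧_)
open import Data.Bool.Properties using () renaming (_≟_ to _≟ᵇ_)
open import Data.Fin using (Fin; zero; suc; punchIn)
open import Data.Fin.Properties using (all?; punchInᵢ≢i) renaming (_≟_ to _≟ᶠ_)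
open import Data.List using (List; _++_; map; allFin; length; deduplicate)
open import Data.List.Membership.Propositional using (_∈_)
open import Data.List.Membership.Propositional.Properties using (deduplicate-∈⇔)
open import Data.List.Membership.Propositional.Properties.WithK using (unique∧set⇒bag)
open import Data.List.Properties using (map-cong)
open import Data.List.Relation.Binary.BagAndSetEquality using (∼bag⇒↭)
open import Data.List.Relation.Binary.Permutation.Propositional using (_↭_; ↭-sym)
open import Data.List.Relation.Binary.Permutation.Propositional.Properties
  using (∈-resp-↭; ↭-length; ++-comm)
open import Data.List.Relation.Unary.Unique.DecPropositional.Properties using (deduplicate-!)
open import Data.Nat.Properties using () renaming (_≟_ to _≟ⁿ_)
open import Data.Product using (_,_; swap)
open import Function.Base using (_∘′_)
open import Function.Bundles using (mk⇔; Equivalence)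
open import Relation.Binary using (DecidableEquality)
open import Relation.Binary.PropositionalEquality
open import Relation.Nullary using (Dec; ¬_; ¬?; contradiction)
open import Relation.Nullary.Decidable using (map′; True; toWitness; _×-dec_; _→-dec_)
open import Relation.Unary using (Decidable)

dedup-length-↭ : ∀ {a} {A : Set a} (_≟_ : DecidableEquality A) {xs ys : List A} →
  xs ↭ ys → length (deduplicate _≟_ xs) ≡ length (deduplicate _≟_ ys)
dedup-length-↭ {A = A} _≟_ {xs} {ys} xs↭ys = ↭-length (∼bag⇒↭ (unique∧set⇒bag
  (deduplicate-! _≟_ xs) (deduplicate-! _≟_ ys)
  (mk⇔ (∈-deduplicate-resp-↭ xs↭ys) (∈-deduplicate-resp-↭ (↭-sym xs↭ys)))))
  where
  ∈-deduplicate-resp-↭ : ∀ {us vs : List A} {z} →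
    us ↭ vs → z ∈ deduplicate _≟_ us → z ∈ deduplicate _≟_ vs
  ∈-deduplicate-resp-↭ p = Equivalence.to (deduplicate-∈⇔ _≟_)
                         ∘′ ∈-resp-↭ p ∘′ Equivalence.from (deduplicate-∈⇔ _≟_)

∀-Bool? : ∀ {p} {P : Bool → Set p} → Decidable P → Dec (∀ b → P b)
∀-Bool? P? = map′ (λ (p₀ , p₁) → λ { false → p₀ ; true → p₁ }) (λ h → h false , h true)
  (P? false ×-dec P? true)

∀-Z2³? : ∀ {p} {P : Z2³ → Set p} → Decidable P → Dec (∀ x → P x)
∀-Z2³? P? = map′ (λ h (a , b , c) → h a b c) (λ h a b c → h (a , b , c))
  (∀-Bool? λ a → ∀-Bool? λ b → ∀-Bool? λ c → P? (a , b , c))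

by-enumeration : ∀ {p} {P : Z2³ → Set p} (P? : Decidable P) → {True (∀-Z2³? P?)} → ∀ x → P x
by-enumeration P? {holds} = toWitness holds

-- cross x y · z is the determinant of x, y, z over Z_2; for independent x and y it
-- vanishes exactly on the plane they span.
infix 7 _·_

_·_ : Z2³ → Z2³ → Bool
(a , b , c) · (x , y , z) = (a ∧ x) xor ((b ∧ y) xor (c ∧ z))

cross : Z2³ → Z2³ → Z2³
cross (a , b , c) (x , y , z) = ((b ∧ z) xor (c ∧ y)) , ((c ∧ x) xor (a ∧ z)) , ((a ∧ y) xor (b ∧ x))

triple : Z2³ → Z2³ → Fin 3 → Z2³
triple x y zero = x
triple x y (suc zero) = y
triple x y (suc (suc zero)) = x ⊕ y

⊕-cancel-zero : ∀ a b c → a ⊕ (b ⊕ c) ≡ zero³ → c ≡ a ⊕ b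
⊕-cancel-zero = by-enumeration λ a → ∀-Z2³? λ b → ∀-Z2³? λ c →
  (a ⊕ (b ⊕ c)) ≟³ zero³ →-dec c ≟³ (a ⊕ b)

·-distribˡ-⊕ : ∀ n x y → n · (x ⊕ y) ≡ n · x xor n · y
·-distribˡ-⊕ = by-enumeration λ n → ∀-Z2³? λ x → ∀-Z2³? λ y →
  n · (x ⊕ y) ≟ᵇ n · x xor n · y

cross-orthogonal : ∀ x y m → cross x y · triple x y m ≡ false
cross-orthogonal = by-enumeration λ x → ∀-Z2³? λ y → all? λ m →
  cross x y · triple x y m ≟ᵇ false

cross-nonzero : ∀ x y → x ≢ zero³ → y ≢ zero³ → x ⊕ y ≢ zero³ → cross x y ≢ zero³
cross-nonzero = by-enumeration λ x → ∀-Z2³? λ y →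
  ¬? (x ≟³ zero³) →-dec ¬? (y ≟³ zero³) →-dec ¬? ((x ⊕ y) ≟³ zero³) →-dec ¬? (cross x y ≟³ zero³)

-- If two entries of the second triple lay in the plane spanned by the first, so would
-- their sum, the third one; then all six values would lie in a set of four elements.
rich⇒off-plane : ∀ x y u v i k → cross x y ≢ zero³ →
  length (deduplicate _≟³_ (map (triple x y) (allFin 3) ++ map (triple u v) (allFin 3))) ≡ 5 →
  cross x y · triple u v i ≡ false → k ≢ i → cross x y · triple u v k ≡ true
rich⇒off-plane = by-enumeration λ x → ∀-Z2³? λ y → ∀-Z2³? λ u → ∀-Z2³? λ v →
  all? λ i → all? λ k →
  ¬? (cross x y ≟³ zero³)
    →-dec (length (deduplicate _≟³_ (map (triple x y) (allFin 3) ++ map (triple u v) (allFin 3))) ≟ⁿ 5)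
    →-dec (cross x y · triple u v i ≟ᵇ false)
    →-dec ¬? (k ≟ᶠ i)
    →-dec (cross x y · triple u v k ≟ᵇ true)

module _ {θ : Labelling} (flow : NowhereZeroFlow θ) where
  open NowhereZeroFlow flow
  open ≡-Reasoning

  row-triple : ∀ i m → θ (i , m) ≡ triple (θ (i , zero)) (θ (i , suc zero)) m
  row-triple i zero = refl
  row-triple i (suc zero) = refl
  row-triple i (suc (suc zero)) =
    ⊕-cancel-zero (θ (i , zero)) (θ (i , suc zero)) (θ (i , suc (suc zero))) (conservation (L i))

  column-triple : ∀ j m → θ (m , j) ≡ triple (θ (zero , j)) (θ (suc zero , j)) m
  column-triple j zero = refl
  column-triple j (suc zero) = refl
  column-triple j (suc (suc zero)) =
    ⊕-cancel-zero (θ (zero , j)) (θ (suc zero , j)) (θ (suc (suc zero) , j)) (conservation (R j))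

  unionSize-triples : ∀ i j → unionSize θ (i , j) ≡
    length (deduplicate _≟³_ (map (triple (θ (i , zero)) (θ (i , suc zero))) (allFin 3)
                              ++ map (triple (θ (zero , j)) (θ (suc zero , j))) (allFin 3)))
  unionSize-triples i j = cong₂ (λ xs ys → length (deduplicate _≟³_ (xs ++ ys)))
    (map-cong (row-triple i) (allFin 3)) (map-cong (column-triple j) (allFin 3))

  rowNormal : Fin 3 → Z2³
  rowNormal i = cross (θ (i , zero)) (θ (i , suc zero))

  rowNormal-nonzero : ∀ i → rowNormal i ≢ zero³
  rowNormal-nonzero i = cross-nonzero (θ (i , zero)) (θ (i , suc zero))
    (nowhereZero (i , zero)) (nowhereZero (i , suc zero))
    (λ sum≡0 → nowhereZero (i , suc (suc zero)) (trans (row-triple i (suc (suc zero))) sum≡0))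

  rich⇒off-row-plane : ∀ {i j} k → Rich θ (i , j) → k ≢ i → rowNormal i · θ (k , j) ≡ true
  rich⇒off-row-plane {i} {j} k rich k≢i = begin
    rowNormal i · θ (k , j)        ≡⟨ cong (rowNormal i ·_) (column-triple j k) ⟩
    rowNormal i · triple u v k     ≡⟨ rich⇒off-plane x y u v i k (rowNormal-nonzero i)
                                        (trans (sym (unionSize-triples i j)) rich) shared-in-plane k≢i ⟩
    true                           ∎
    where
    x = θ (i , zero)
    y = θ (i , suc zero)
    u = θ (zero , j)
    v = θ (suc zero , j)
    shared-in-plane : rowNormal i · triple u v i ≡ false
    shared-in-plane = begin
      rowNormal i · triple u v i   ≡⟨ cong (rowNormal i ·_) (sym (column-triple j i)) ⟩
      rowNormal i · θ (i , j)      ≡⟨ cong (rowNormal i ·_) (row-triple i j) ⟩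
      rowNormal i · triple x y j   ≡⟨ cross-orthogonal x y j ⟩
      false                        ∎

  no-rich-row : ∀ i → ¬ (∀ j → Rich θ (i , j))
  no-rich-row i rich = contradiction (begin
    true                                       ≡⟨ sym (off-plane (suc (suc zero))) ⟩
    n · θ (k , suc (suc zero))                 ≡⟨ cong (n ·_) (row-triple k (suc (suc zero))) ⟩
    n · (θ (k , zero) ⊕ θ (k , suc zero))      ≡⟨ ·-distribˡ-⊕ n (θ (k , zero)) (θ (k , suc zero)) ⟩
    n · θ (k , zero) xor n · θ (k , suc zero)  ≡⟨ cong₂ _xor_ (off-plane zero) (off-plane (suc zero)) ⟩
    false                                      ∎) λ ()
    where
    n = rowNormal i
    k = punchIn i zero
    off-plane : ∀ j → n · θ (k , j) ≡ true
    off-plane j = rich⇒off-row-plane k (rich j) (punchInᵢ≢i i zero)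

transpose : Labelling → Labelling
transpose θ = θ ∘′ swap

transpose-flow : ∀ {θ} → NowhereZeroFlow θ → NowhereZeroFlow (transpose θ)
transpose-flow flow = record
  { nowhereZero  = λ e → nowhereZero (swap e)
  ; conservation = λ { (L i) → conservation (R i) ; (R j) → conservation (L j) }
  }
  where open NowhereZeroFlow flow

unionSize-transpose : ∀ θ i j → unionSize (transpose θ) (j , i) ≡ unionSize θ (i , j)
unionSize-transpose θ i j = dedup-length-↭ _≟³_ (++-comm (S θ (R j)) (S θ (L i)))

proposition2 : (θ : Labelling) → NowhereZeroFlow θ → (v : Vertex) →
    ¬ (∀ e → Incident v e → Rich θ e)
proposition2 θ flow (L i) rich = no-rich-row flow i (λ j → rich (i , j) refl)
proposition2 θ flow (R j) rich = no-rich-row (transpose-flow flow) j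
  (λ i → trans (unionSize-transpose θ i j) (rich (i , j) refl))
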